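{- Let $G$ be a graph with a minimum geodetic set $S$ such that for every vertex $x\in S$ there exist two vertices $y,z\in S\setminus\{x\}$ with $x\in I[y,z]$. Then, for every positive integer $n$, $g(G\boxtimes K_n)=g(G)$.
   Context: All graphs are finite, simple and connected. For vertices $x,y$ of a graph, the closed interval $I[x,y]$ consists of $x$, $y$ and all vertices lying on some shortest $x$–$y$ path; for a vertex set $S$, $I[S]=\bigcup_{u,v\in S}I[u,v]$. A set $S$ is geodetic if $I[S]=V(G)$, and the geodetic number $g(G)$ is the minimum cardinality of a geodetic set. $K_n$ is the complete graph of order $n$. The strong product $G\boxtimes H$ has vertex set $V(G)\times V(H)$, with $(g,h)$ and $(g',h')$ adjacent whenever ($g=g'$ and $hh'\in E(H)$), or ($h=h'$ and $gg'\in E(G)$), or ($gg'\in E(G)$ and $hh'\in E(H)$). -}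

module Defs where

open import Data.Nat using (ℕ; zero; suc; _+_; _*_; _≤_)
open import Data.Fin using (Fin; remQuot)
open import Data.Fin.Subset using (Subset; _∈_; ∣_∣)
open import Data.Product using (Σ; ∃; ∃-syntax; _×_; _,_; proj₁; proj₂)
open import Data.Sum using (_⊎_)
open import Relation.Binary.PropositionalEquality using (_≡_; _≢_)
open import Relation.Nullary using (¬_)
open import Level using (0ℓ)

record Graph : Set₁ where
  field
    order  : ℕ
    Adj    : Fin order → Fin order → Set
    sym    : ∀ {x y} → Adj x y → Adj y x
    irrefl : ∀ {x} → ¬ Adj x x

open Graph public

Vertex : Graph → Set
Vertex G = Fin (order G)

data Walk (G : Graph) : Vertex G → Vertex G → ℕ → Set where
  nil  : ∀ {x} → Walk G x x zero
  cons : ∀ {x y z k} → Adj G x y → Walk G y z k → Walk G x z (suc k)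

data OnWalk (G : Graph) (v : Vertex G) : ∀ {x y k} → Walk G x y k → Set where
  here  : ∀ {y k} {w : Walk G v y k} → OnWalk G v w
  there : ∀ {x y z k} {e : Adj G x y} {w : Walk G y z k} →
          OnWalk G v w → OnWalk G v (cons e w)

Connected : Graph → Set
Connected G = ∀ x y → ∃[ k ] Walk G x y k

Dist : (G : Graph) → Vertex G → Vertex G → ℕ → Set
Dist G x y d = Walk G x y d × (∀ k → Walk G x y k → d ≤ k)

-- v ∈ I[x,y]: v lies on some shortest x–y walk (a shortest walk is a path;
-- x and y lie on every x–y walk)
InInterval : (G : Graph) → Vertex G → Vertex G → Vertex G → Set
InInterval G v x y =
  ∃[ d ] (Dist G x y d × Σ (Walk G x y d) (λ w → OnWalk G v w))

Geodetic : (G : Graph) → Subset (order G) → Set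
Geodetic G S =
  ∀ v → ∃[ u ] ∃[ w ] (u ∈ S × w ∈ S × InInterval G v u w)

MinimumGeodetic : (G : Graph) → Subset (order G) → Set
MinimumGeodetic G S = Geodetic G S × (∀ T → Geodetic G T → ∣ S ∣ ≤ ∣ T ∣)

GeodeticNumber : Graph → ℕ → Set
GeodeticNumber G k =
  ∃[ S ] (Geodetic G S × ∣ S ∣ ≡ k) × (∀ T → Geodetic G T → k ≤ ∣ T ∣)

K : ℕ → Graph
K n = record
  { order = n ; Adj = λ i j → i ≢ j
  ; sym = λ p q → p (Relation.Binary.PropositionalEquality.sym q)
  ; irrefl = λ p → p Relation.Binary.PropositionalEquality.refl }

-- strong product; vertex (g , h) encoded as combine g h
StrongAdj : (G H : Graph) → Vertex G × Vertex H → Vertex G × Vertex H → Set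
StrongAdj G H (g , h) (g' , h') =
  (g ≡ g' × Adj H h h') ⊎ (h ≡ h' × Adj G g g') ⊎ (Adj G g g' × Adj H h h')

_⊠_ : Graph → Graph → Graph
G ⊠ H = record
  { order = order G * order H
  ; Adj = λ p q → StrongAdj G H (remQuot (order H) p) (remQuot (order H) q)
  ; sym = symm
  ; irrefl = irr }
  where
  open import Data.Sum using (inj₁; inj₂)
  open import Relation.Binary.PropositionalEquality as Eq
  symm : ∀ {p q} → StrongAdj G H p q → StrongAdj G H q p
  symm (inj₁ (e , a)) = inj₁ (Eq.sym e , Graph.sym H a)
  symm (inj₂ (inj₁ (e , a))) = inj₂ (inj₁ (Eq.sym e , Graph.sym G a))
  symm (inj₂ (inj₂ (a , b))) = inj₂ (inj₂ (Graph.sym G a , Graph.sym H b))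
  irr : ∀ {p} → ¬ StrongAdj G H p p
  irr (inj₁ (_ , a)) = Graph.irrefl H a
  irr (inj₂ (inj₁ (_ , a))) = Graph.irrefl G a
  irr (inj₂ (inj₂ (a , _))) = Graph.irrefl G a

module Submission where

-- Write P = G ⊠ Kₙ and let π : V(P) → V(G) be the projection.
-- Every edge of P moves the G-coordinate by at most one edge, so a walk of P
-- casts a "shadow" walk in G that is no longer and meets the projection of
-- every vertex of the original walk.  Conversely every walk of G lifts to P
-- with arbitrary labels in Kₙ, since any two labels are equal or adjacent.
-- Hence geodesics lift to geodesics (for any labelling of the vertices of G)
-- and project to geodesics, i.e. intervals of G and P correspond.
--
--  * Lower bound: if T is geodetic in P then π(T) is geodetic in G, and
--    |π(T)| ≤ |T|; so g(P) ≥ g(G).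
--  * Upper bound: S × {0} is geodetic in P.  A vertex (v, h) lies in the
--    interval of (y, 0) and (z, 0) where y, z ∈ S are different from v and
--    v ∈ I[y, z] (this is where the hypothesis on S is used): label v by h
--    and every other vertex by 0, and lift a geodesic through v.

open import Defs
open import Data.Nat using (ℕ; _≤_)
open import Data.Fin.Subset using (Subset; _∈_; ∣_∣)
open import Data.Product using (Σ; ∃; ∃-syntax; _×_)
open import Relation.Binary.PropositionalEquality using (_≢_)

open import Data.Nat using (zero; suc; z≤n; s≤s)
open import Data.Nat.Properties using (≤-trans; ≤-antisym; ≤-reflexive; n≤1+n; ≤-refl; module ≤-Reasoning)
open import Data.Fin using (Fin; combine; remQuot; _≟_)
  renaming (zero to fzero; suc to fsuc)
open import Data.Fin.Properties using (remQuot-combine; combine-remQuot; combine-injectiveˡ; any?; suc-injective; 0≢1+n)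
open import Data.Fin.Subset using (inside; outside; _-_)
open import Data.Fin.Subset.Properties using (_∈?_; x∈p∧x≢y⇒x∈p-y; x∈p⇒∣p-x∣<∣p∣)
open import Data.Vec using ([]; _∷_; tabulate; here; there)
open import Data.Vec.Properties using (lookup∘tabulate; lookup⇒[]=; []=⇒lookup)
open import Data.Product using (_,_; proj₁; proj₂)
open import Data.Sum using (_⊎_; inj₁; inj₂)
open import Data.Empty using (⊥-elim)
open import Function using (_∘_)
open import Relation.Nullary using (yes; no; does)
open import Relation.Nullary.Decidable using (_×-dec_; dec-true)
open import Relation.Unary using (Decidable)
open import Relation.Binary.PropositionalEquality
  using (_≡_; refl; trans; cong; cong₂; subst; subst₂)
  renaming (sym to ≡-sym)

⟦_⟧ : ∀ {m} {P : Fin m → Set} → Decidable P → Subset m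
⟦ P? ⟧ = tabulate (does ∘ P?)

∈⟦⟧⁺ : ∀ {m} {P : Fin m → Set} (P? : Decidable P) {x} → P x → x ∈ ⟦ P? ⟧
∈⟦⟧⁺ P? {x} px =
  lookup⇒[]= x _ (trans (lookup∘tabulate (does ∘ P?) x) (dec-true (P? x) px))

∈⟦⟧⁻ : ∀ {m} {P : Fin m → Set} (P? : Decidable P) {x} → x ∈ ⟦ P? ⟧ → P x
∈⟦⟧⁻ P? {x} x∈ with P? x | trans (≡-sym (lookup∘tabulate (does ∘ P?) x)) ([]=⇒lookup x∈)
... | yes px | _ = px
... | no _   | ()

-- Counting by injections: a map defined on the members of A, injective and
-- landing in B, shows ∣ A ∣ ≤ ∣ B ∣.  Each member of A removes its image from B.
card-≤-injection : ∀ {m p} {A : Subset m} {B : Subset p}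
  (f : ∀ x → x ∈ A → Fin p) →
  (∀ x (x∈A : x ∈ A) → f x x∈A ∈ B) →
  (∀ x y (x∈A : x ∈ A) (y∈A : y ∈ A) → f x x∈A ≡ f y y∈A → x ≡ y) →
  ∣ A ∣ ≤ ∣ B ∣
card-≤-injection {A = []} f maps inj = z≤n
card-≤-injection {A = outside ∷ A} f maps inj =
  card-≤-injection (λ x x∈A → f (fsuc x) (there x∈A))
    (λ x x∈A → maps (fsuc x) (there x∈A))
    (λ x y x∈A y∈A eq → suc-injective (inj (fsuc x) (fsuc y) (there x∈A) (there y∈A) eq))
card-≤-injection {A = inside ∷ A} {B} f maps inj = begin-strict
  ∣ A ∣                  ≤⟨ card-≤-injection (λ x x∈A → f (fsuc x) (there x∈A)) maps-rest inj-rest ⟩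
  ∣ B - f fzero here ∣   <⟨ x∈p⇒∣p-x∣<∣p∣ (maps fzero here) ⟩
  ∣ B ∣                  ∎
  where
  open ≤-Reasoning
  maps-rest : ∀ x (x∈A : x ∈ A) → f (fsuc x) (there x∈A) ∈ B - f fzero here
  maps-rest x x∈A = x∈p∧x≢y⇒x∈p-y (maps (fsuc x) (there x∈A))
    (λ eq → 0≢1+n (≡-sym (inj (fsuc x) fzero (there x∈A) here eq)))
  inj-rest : ∀ x y (x∈A : x ∈ A) (y∈A : y ∈ A) →
    f (fsuc x) (there x∈A) ≡ f (fsuc y) (there y∈A) → x ≡ y
  inj-rest x y x∈A y∈A eq = suc-injective (inj (fsuc x) (fsuc y) (there x∈A) (there y∈A) eq)

InImage : ∀ {m p} → (Fin m → Fin p) → Subset m → Fin p → Set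
InImage f A b = ∃[ a ] (a ∈ A × f a ≡ b)

inImage? : ∀ {m p} (f : Fin m → Fin p) (A : Subset m) → Decidable (InImage f A)
inImage? f A b = any? (λ a → (a ∈? A) ×-dec (f a ≟ b))

image : ∀ {m p} → (Fin m → Fin p) → Subset m → Subset p
image f A = ⟦ inImage? f A ⟧

module _ {m p} (f : Fin m → Fin p) (A : Subset m) where

  ∈-image⁺ : ∀ {a} → a ∈ A → f a ∈ image f A
  ∈-image⁺ {a} a∈A = ∈⟦⟧⁺ (inImage? f A) (a , a∈A , refl)

  ∈-image⁻ : ∀ {b} → b ∈ image f A → InImage f A b
  ∈-image⁻ = ∈⟦⟧⁻ (inImage? f A)

  -- Choosing a preimage is injective on the image.
  ∣image∣≤ : ∣ image f A ∣ ≤ ∣ A ∣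
  ∣image∣≤ = card-≤-injection (λ b b∈ → proj₁ (∈-image⁻ b∈))
    (λ b b∈ → proj₁ (proj₂ (∈-image⁻ b∈)))
    (λ b c b∈ c∈ eq → trans (≡-sym (proj₂ (proj₂ (∈-image⁻ b∈))))
                        (trans (cong f eq) (proj₂ (proj₂ (∈-image⁻ c∈)))))

  ∣image∣≡ : (∀ a b → f a ≡ f b → a ≡ b) → ∣ image f A ∣ ≡ ∣ A ∣
  ∣image∣≡ f-inj = ≤-antisym ∣image∣≤
    (card-≤-injection (λ a _ → f a) (λ a a∈A → ∈-image⁺ a∈A) (λ a b _ _ → f-inj a b))

module _ (G : Graph) where

  walk-length-zero : ∀ {a b} → Walk G a b 0 → a ≡ b
  walk-length-zero nil = refl

  closed-walk-short : ∀ {a b k} → a ≡ b → Walk G a b k → k ≤ 1 → k ≡ 0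
  closed-walk-short refl nil                 _        = refl
  closed-walk-short refl (cons e nil)        _        = ⊥-elim (irrefl G e)
  closed-walk-short refl (cons _ (cons _ _)) (s≤s ())

  prepend : ∀ {a b c j} → a ≡ b ⊎ Adj G a b → (w : Walk G b c j) →
    Σ ℕ λ j' → j' ≤ suc j × Σ (Walk G a c j') λ w' →
      OnWalk G a w' × (∀ {v} → OnWalk G v w → OnWalk G v w')
  prepend (inj₁ refl) w = _ , n≤1+n _ , w , here , (λ on → on)
  prepend (inj₂ e)    w = _ , ≤-refl , cons e w , here , there

  -- Every vertex lies in the interval of two vertices of S other than itself:
  -- for vertices of S this is the hypothesis, for the others geodeticity of S.
  interval-avoiding : (S : Subset (order G)) → Geodetic G S →
    (∀ x → x ∈ S → ∃[ y ] ∃[ z ] (y ∈ S × z ∈ S × y ≢ x × z ≢ x × InInterval G x y z)) →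
    ∀ v → ∃[ y ] ∃[ z ] (y ∈ S × z ∈ S × y ≢ v × z ≢ v × InInterval G v y z)
  interval-avoiding S geodetic inner v with v ∈? S
  ... | yes v∈S = inner v v∈S
  ... | no v∉S with geodetic v
  ...   | y , z , y∈S , z∈S , v∈I =
    y , z , y∈S , z∈S , (λ y≡v → v∉S (subst (_∈ S) y≡v y∈S)) ,
    (λ z≡v → v∉S (subst (_∈ S) z≡v z∈S)) , v∈I

module StrongProduct (G H : Graph) where

  π : Vertex (G ⊠ H) → Vertex G
  π p = proj₁ (remQuot {order G} (order H) p)

  ρ : Vertex (G ⊠ H) → Vertex H
  ρ p = proj₂ (remQuot {order G} (order H) p)

  ⟨_∣_⟩ : Vertex G → Vertex H → Vertex (G ⊠ H)
  ⟨ g ∣ h ⟩ = combine g h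

  π⟨⟩ : ∀ g h → π ⟨ g ∣ h ⟩ ≡ g
  π⟨⟩ g h = cong proj₁ (remQuot-combine g h)

  ⟨π∣ρ⟩ : ∀ p → ⟨ π p ∣ ρ p ⟩ ≡ p
  ⟨π∣ρ⟩ p = combine-remQuot {order G} (order H) p

  step : ∀ {p q} → Adj (G ⊠ H) p q → π p ≡ π q ⊎ Adj G (π p) (π q)
  step (inj₁ (same , _))        = inj₁ same
  step (inj₂ (inj₁ (_ , e)))    = inj₂ e
  step (inj₂ (inj₂ (e , _)))    = inj₂ e

  record Shadow {p q k} (w : Walk (G ⊠ H) p q k) : Set where
    field
      length  : ℕ
      shorter : length ≤ k
      walk    : Walk G (π p) (π q) length
      covers  : ∀ {v} → OnWalk (G ⊠ H) v w → OnWalk G (π v) walk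

  shadow : ∀ {p q k} (w : Walk (G ⊠ H) p q k) → Shadow w
  shadow nil = record { length = 0 ; shorter = z≤n ; walk = nil ; covers = λ { here → here } }
  shadow (cons e w) with shadow w
  ... | record { shorter = shorter ; walk = walk ; covers = covers }
    with prepend G (step e) walk
  ...   | j' , j'≤ , w' , start , extend = record
    { length  = j'
    ; shorter = ≤-trans j'≤ (s≤s shorter)
    ; walk    = w'
    ; covers  = λ { here → start ; (there on) → extend (covers on) } }

  dist-lower : ∀ {p q d j} → Dist G (π p) (π q) d → Walk (G ⊠ H) p q j → d ≤ j
  dist-lower (_ , minimal) w = ≤-trans (minimal _ walk) shorter
    where open Shadow (shadow w)

module StrongProductWithComplete (G : Graph) (n : ℕ) where

  open StrongProduct G (K n) public

  P : Graph
  P = G ⊠ K n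

  -- Two labels are equal or adjacent in Kₙ, so every edge of G lifts.
  lift-edge : ∀ {g g'} → Adj G g g' → ∀ h h' → Adj P ⟨ g ∣ h ⟩ ⟨ g' ∣ h' ⟩
  lift-edge {g} {g'} e h h' =
    subst₂ (StrongAdj G (K n)) (≡-sym (remQuot-combine g h)) (≡-sym (remQuot-combine g' h'))
      (edge h h')
    where
    edge : ∀ h h' → StrongAdj G (K n) (g , h) (g' , h')
    edge h h' with h ≟ h'
    ... | yes same = inj₂ (inj₁ (same , e))
    ... | no  diff = inj₂ (inj₂ (e , diff))

  lift : (f : Vertex G → Fin n) → ∀ {x z k} → Walk G x z k → Walk P ⟨ x ∣ f x ⟩ ⟨ z ∣ f z ⟩ k
  lift f nil        = nil
  lift f (cons e w) = cons (lift-edge e _ _) (lift f w)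

  lift-covers : (f : Vertex G → Fin n) → ∀ {v x z k} (w : Walk G x z k) →
    OnWalk G v w → OnWalk P ⟨ v ∣ f v ⟩ (lift f w)
  lift-covers f w          here      = here
  lift-covers f (cons e w) (there on) = there (lift-covers f w on)

  lift-pinned : ∀ {x z k} (h h' : Fin n) → Walk G x z (suc k) → Walk P ⟨ x ∣ h ⟩ ⟨ z ∣ h' ⟩ (suc k)
  lift-pinned h h' (cons e w) = cons (lift-edge e h h') (lift (λ _ → h') w)

  fibre-walk : ∀ {u w} → π u ≡ π w → Σ ℕ λ j → j ≤ 1 × Walk P u w j
  fibre-walk {u} {w} same with ρ u ≟ ρ w
  ... | yes same' = 0 , z≤n , subst (λ b → Walk P u b 0) u≡w nil
    where
    u≡w : u ≡ w
    u≡w = trans (≡-sym (⟨π∣ρ⟩ u)) (trans (cong₂ ⟨_∣_⟩ same same') (⟨π∣ρ⟩ w))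
  ... | no diff = 1 , ≤-refl , cons (inj₁ (same , diff)) nil

  geodesic-lift : ∀ {x z d} (f : Vertex G → Fin n) → Dist G x z d → Dist P ⟨ x ∣ f x ⟩ ⟨ z ∣ f z ⟩ d
  geodesic-lift {x} {z} {d} f dist@(w , _) =
    lift f w , λ j → dist-lower (subst₂ (λ a b → Dist G a b d) (≡-sym (π⟨⟩ x (f x))) (≡-sym (π⟨⟩ z (f z))) dist)

  interval-lift : ∀ {v x z} (f : Vertex G → Fin n) → InInterval G v x z →
    InInterval P ⟨ v ∣ f v ⟩ ⟨ x ∣ f x ⟩ ⟨ z ∣ f z ⟩
  interval-lift f (d , dist , w , on) = d , geodesic-lift f dist , lift f w , lift-covers f w on

  -- A shorter walk of
  -- G would lift to a shorter walk of G ⊠ Kₙ, except for a walk of length zero,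
  -- where the ends lie in one fibre and so are at distance at most one.
  geodesic-project : ∀ {u w d} → Dist P u w d → (W : Walk P u w d) →
    Dist G (π u) (π w) (Shadow.length (shadow W))
  geodesic-project {u} {w} (_ , minimal) W = walk , shortest
    where
    open Shadow (shadow W)
    shortest : ∀ j → Walk G (π u) (π w) j → length ≤ j
    shortest (suc j) W' = ≤-trans shorter
      (minimal (suc j) (subst₂ (λ a b → Walk P a b (suc j)) (⟨π∣ρ⟩ u) (⟨π∣ρ⟩ w) (lift-pinned (ρ u) (ρ w) W')))
    shortest zero W' with fibre-walk (walk-length-zero G W')
    ... | j , j≤1 , V = ≤-reflexive
      (closed-walk-short G (walk-length-zero G W') walk (≤-trans shorter (≤-trans (minimal j V) j≤1)))

  interval-project : ∀ {p u w} → InInterval P p u w → InInterval G (π p) (π u) (π w)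
  interval-project (d , dist , W , on) =
    Shadow.length (shadow W) , geodesic-project dist W , Shadow.walk (shadow W) , Shadow.covers (shadow W) on

  -- The projection of a geodetic set of G ⊠ Kₙ is geodetic in G (n ≥ 1,
  -- witnessed by a label o).
  geodetic-project : Fin n → ∀ T → Geodetic P T → Geodetic G (image π T)
  geodetic-project o T geodetic v with geodetic ⟨ v ∣ o ⟩
  ... | u , w , u∈T , w∈T , v∈I =
    π u , π w , ∈-image⁺ π T u∈T , ∈-image⁺ π T w∈T ,
    subst (λ a → InInterval G a (π u) (π w)) (π⟨⟩ v o) (interval-project v∈I)

  mark : Vertex G → Fin n → Fin n → Vertex G → Fin n
  mark v h o u with u ≟ v
  ... | yes _ = h
  ... | no  _ = o

  mark-here : ∀ v h o → mark v h o v ≡ h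
  mark-here v h o with v ≟ v
  ... | yes _    = refl
  ... | no  v≢v = ⊥-elim (v≢v refl)

  mark-elsewhere : ∀ {v u} h o → u ≢ v → mark v h o u ≡ o
  mark-elsewhere {v} {u} h o u≢v with u ≟ v
  ... | yes u≡v = ⊥-elim (u≢v u≡v)
  ... | no  _   = refl

  layer : Fin n → Subset (order G) → Subset (order P)
  layer o S = image (λ g → ⟨ g ∣ o ⟩) S

  ∣layer∣ : ∀ o S → ∣ layer o S ∣ ≡ ∣ S ∣
  ∣layer∣ o S = ∣image∣≡ (λ g → ⟨ g ∣ o ⟩) S (λ g g' → combine-injectiveˡ g o g' o)

  -- If every vertex of G lies in the interval of two vertices of S other than
  -- itself, then S × {o} is geodetic: (v , h) is reached from (y , o) and
  -- (z , o) by lifting a y–z geodesic through v along the labelling mark v h o.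
  geodetic-layer : ∀ o S → Geodetic G S →
    (∀ x → x ∈ S → ∃[ y ] ∃[ z ] (y ∈ S × z ∈ S × y ≢ x × z ≢ x × InInterval G x y z)) →
    Geodetic P (layer o S)
  geodetic-layer o S geodetic inner p with interval-avoiding G S geodetic inner (π p)
  ... | y , z , y∈S , z∈S , y≢v , z≢v , v∈I =
    ⟨ y ∣ o ⟩ , ⟨ z ∣ o ⟩ , ∈-image⁺ (λ g → ⟨ g ∣ o ⟩) S y∈S , ∈-image⁺ (λ g → ⟨ g ∣ o ⟩) S z∈S ,
    relabel (interval-lift f v∈I)
    where
    f : Vertex G → Fin n
    f = mark (π p) (ρ p) o
    relabel : InInterval P ⟨ π p ∣ f (π p) ⟩ ⟨ y ∣ f y ⟩ ⟨ z ∣ f z ⟩ →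
              InInterval P p ⟨ y ∣ o ⟩ ⟨ z ∣ o ⟩
    relabel rewrite mark-here (π p) (ρ p) o | mark-elsewhere (ρ p) o y≢v
                  | mark-elsewhere (ρ p) o z≢v | ⟨π∣ρ⟩ p = λ p∈I → p∈I

minimum-size : ∀ G S k → MinimumGeodetic G S → GeodeticNumber G k → ∣ S ∣ ≡ k
minimum-size G S k (geodetic , minimum) (S₀ , (geodetic₀ , ∣S₀∣≡k) , lower) =
  ≤-antisym (subst (∣ S ∣ ≤_) ∣S₀∣≡k (minimum S₀ geodetic₀)) (lower S geodetic)

proposition5 : (G : Graph) → Connected G → (S : Subset (order G)) →
    MinimumGeodetic G S →
    (∀ x → x ∈ S → ∃[ y ] ∃[ z ] (y ∈ S × z ∈ S × y ≢ x × z ≢ x × InInterval G x y z)) →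
    (n : ℕ) → 1 ≤ n → (k : ℕ) → GeodeticNumber G k → GeodeticNumber (G ⊠ K n) k
proposition5 G _ S minimumS inner (suc n) (s≤s z≤n) k g≡k@(_ , _ , lower) =
  layer fzero S ,
  (geodetic-layer fzero S (proj₁ minimumS) inner , trans (∣layer∣ fzero S) (minimum-size G S k minimumS g≡k)) ,
  λ T geodetic → ≤-trans (lower (image π T) (geodetic-project fzero T geodetic)) (∣image∣≤ π T)
  where open StrongProductWithComplete G (suc n)
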